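{- Let $n\ge1$, $i,j\in\{ -n-1,\dots,n+1\}$ and $R_i$ as in the context. If $|i|>|j|$ then $R_i\circ R_j=R_i$.
   Context: For $p=(p_1,\dots,p_n)\in\mathbb Q^n$: $(p,q)\in L_1$ iff $p_1<q_1$; for $2\le i\le n$, $(p,q)\in L_i$ iff $(p_1,\dots,p_{i-1})=(q_1,\dots,q_{i-1})$ and $p_i<q_i$. Let $<_n=L_1\cup\dots\cup L_n$. $X=\mathbb Q^n\times\{ -1,1\}$, writing $p^b$ for $(p,b)$, with $p^b\le_X q^d$ iff $p^b=q^d$ or $p<_nq$; $\alpha(p^b)=p^{ -b}$. For $R\subseteq X^2$, $R^c=X^2\setminus R$, $R^\smile$ the converse, $\circ$ relational composition. $U_j=\{(p^b,q^d)\mid b,d\in\{ -1,1\},(p,q)\in L_j\}$. $R_{ -n-1}=\varnothing$; $R_i=\bigcup_{j=1}^{n+1+i}U_j$ for $-n\le i\le-1$; $R_0={\le_X}$; $R_i=(R_{ -i})^{c\smile}\circ\alpha$ for $1\le i\le n+1$. -}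

module Defs where

open import Data.Nat using (ℕ; zero; suc; _∸_) renaming (_<_ to _<ℕ_)
open import Data.Integer using (ℤ; +_; -[1+_])
open import Data.Rational using (ℚ) renaming (_<_ to _<ℚ_)
open import Data.Fin using (Fin; toℕ)
open import Data.Vec using (Vec; lookup)
open import Data.Sign using (Sign) renaming (opposite to flip)
open import Data.Product using (Σ; _×_; _,_)
open import Data.Sum using (_⊎_)
open import Relation.Nullary using (¬_)
open import Relation.Binary.PropositionalEquality using (_≡_)

-- Points of ℚ^n; coordinate p_{k+1} is  lookup p k  (k : Fin n, 0-based).
Pt : ℕ → Set
Pt n = Vec ℚ n

-- L k  corresponds to the paper's L_{k+1}:
-- p, q agree on the first k coordinates and p_{k+1} < q_{k+1}.
L : {n : ℕ} → Fin n → Pt n → Pt n → Set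
L {n} k p q = ((m : Fin n) → toℕ m <ℕ toℕ k → lookup p m ≡ lookup q m) × (lookup p k <ℚ lookup q k)

_<ₙ_ : {n : ℕ} → Pt n → Pt n → Set
_<ₙ_ {n} p q = Σ (Fin n) λ k → L k p q

-- X = ℚ^n × {-1,1}  (signs -1, 1 represented by Data.Sign.Sign)
X : ℕ → Set
X n = Pt n × Sign

Rel : ℕ → Set₁
Rel n = X n → X n → Set

α : {n : ℕ} → X n → X n
α (p , b) = (p , flip b)

αRel : {n : ℕ} → Rel n
αRel x y = y ≡ α x

_ᶜ : {n : ℕ} → Rel n → Rel n
(R ᶜ) x y = ¬ R x y

_⌣ : {n : ℕ} → Rel n → Rel n
(R ⌣) x y = R y x

_∘ᵣ_ : {n : ℕ} → Rel n → Rel n → Rel n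
(R ∘ᵣ S) x z = Σ (X _) λ y → R x y × S y z

_≤X_ : {n : ℕ} → Rel n
x ≤X y = (x ≡ y) ⊎ (Data.Product.proj₁ x <ₙ Data.Product.proj₁ y)

-- U_{k+1} (k : Fin n)
U : {n : ℕ} → Fin n → Rel n
U k (p , b) (q , d) = L k p q

-- R at a negative index -(m+1): union of U_j for 1 ≤ j ≤ n+1+i = n - m,
-- i.e. 0-based k with toℕ k < n ∸ m.  For m = n (i = -n-1) this is empty.
Rneg : {n : ℕ} → ℕ → Rel n
Rneg {n} m x y = Σ (Fin n) λ k → (toℕ k <ℕ n ∸ m) × U k x y

-- R_i for i ∈ ℤ (only meaningful for -n-1 ≤ i ≤ n+1)
R : {n : ℕ} → ℤ → Rel n
R (+ zero)    = _≤X_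
R (+ suc m)   = ((Rneg m) ᶜ ⌣) ∘ᵣ αRel
R (-[1+ m ])  = Rneg m

{-# OPTIONS --safe #-}
-- Write p <[ c ] q when p lies below q at one of the levels L_1, …, L_c.  On the
-- ℚ^n components, R_{-(m+1)} is <[ n ∸ m ], and R_{m+1} relates x to z iff z is
-- not <[ n ∸ m ] below x (α only undoes the sign flip, and no relation looks at
-- signs).  For |j| < |i| the relation R_j works at a depth c' ≥ c, so the
-- inclusion R_i ∘ R_j ⊆ R_i follows from transitivity and cotransitivity of
-- <[ c ].  Conversely, for j ≥ 0 the intermediate point can be z itself
-- (irreflexivity), and for j < 0 it is z with coordinate c' lowered by one: it
-- agrees with z on the first c coordinates and is <[ c' ] below z.
module Submission where

open import Defs
open import Data.Nat using (ℕ; zero; suc; _≤_; _<_; _∸_; _⊓_; s≤s)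
import Data.Nat.Properties as ℕ
open import Data.Nat.Properties
  using (<⇒≤; <-≤-trans; n≤1+n; n<1+n; ⊓-glb; m⊓n≤m; m⊓n≤n; m<1+n⇒m<n∨m≡n;
         m∸n≤m; ∸-monoʳ-≤; ∸-monoʳ-<)
open import Data.Integer using (ℤ; ∣_∣; -_; +_; -[1+_]; -≤-; +≤+)
  renaming (_≤_ to _≤ℤ_)
open import Data.Rational as ℚ using (ℚ; 1ℚ; _-_) renaming (_<_ to _<ℚ_)
import Data.Rational.Properties as ℚₚ
open import Data.Fin using (Fin; toℕ; fromℕ<)
import Data.Fin.Properties as Fin
open import Data.Fin.Properties using (toℕ<n; toℕ-fromℕ<; toℕ-injective)
open import Data.Vec using (lookup; _[_]≔_)
open import Data.Vec.Properties using (lookup∘update; lookup∘update′)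
open import Data.Sign.Properties using (opposite-involutive)
open import Data.Product using (Σ; _×_; _,_; proj₁; proj₂)
open import Data.Sum using (_⊎_; inj₁; inj₂; [_,_])
open import Data.Empty using (⊥-elim)
open import Relation.Nullary using (¬_)
open import Relation.Binary.Definitions using (tri<; tri≈; tri>)
open import Relation.Binary.PropositionalEquality using (_≡_; refl; sym; trans; cong; subst)
open import Function.Bundles using (_⇔_; mk⇔; module Equivalence)
open Equivalence using (to; from)

private
  variable
    n c c' m m' : ℕ
    p q y : Pt n

-- Records rather than Σ-types over L, so that the points can be inferred.
record _≈[_]_ (p : Pt n) (c : ℕ) (q : Pt n) : Set where
  constructor agree
  field at : (m : Fin n) → toℕ m < c → lookup p m ≡ lookup q m
open _≈[_]_

record _<[_]_ (p : Pt n) (c : ℕ) (q : Pt n) : Set where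
  constructor below
  field
    level       : Fin n
    level<c     : toℕ level < c
    agree-below : p ≈[ toℕ level ] q
    <-at-level  : lookup p level <ℚ lookup q level
open _<[_]_ using (agree-below)

≈[]-sym : p ≈[ c ] q → q ≈[ c ] p
≈[]-sym (agree p≈q) = agree λ m m<c → sym (p≈q m m<c)

≈[]-trans : p ≈[ c ] y → y ≈[ c ] q → p ≈[ c ] q
≈[]-trans (agree p≈y) (agree y≈q) = agree λ m m<c → trans (p≈y m m<c) (y≈q m m<c)

≈[]-mono : c ≤ c' → p ≈[ c' ] q → p ≈[ c ] q
≈[]-mono c≤c' (agree p≈q) = agree λ m m<c → p≈q m (<-≤-trans m<c c≤c')

≈[]-extend : {p q : Pt n} (k : Fin n) → p ≈[ toℕ k ] q → lookup p k ≡ lookup q k → p ≈[ suc (toℕ k) ] q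
≈[]-extend {p = p} {q = q} k (agree p≈q) eq = agree extended
  where
  extended : (m : Fin _) → toℕ m < suc (toℕ k) → lookup p m ≡ lookup q m
  extended m m<1+k with m<1+n⇒m<n∨m≡n m<1+k
  ... | inj₁ m<k = p≈q m m<k
  ... | inj₂ m≡k rewrite toℕ-injective m≡k = eq

<[]-trans : p <[ c ] y → y <[ c' ] q → p <[ c ⊓ c' ] q
<[]-trans (below k k<c p≈y p<y) (below k' k'<c' y≈q y<q) with Fin.<-cmp k k'
... | tri< k<k' _ _ = below k (⊓-glb k<c (ℕ.<-trans k<k' k'<c'))
  (≈[]-trans p≈y (≈[]-mono (<⇒≤ k<k') y≈q)) (subst (_ <ℚ_) (at y≈q k k<k') p<y)
... | tri≈ _ refl _ = below k (⊓-glb k<c k'<c') (≈[]-trans p≈y y≈q) (ℚₚ.<-trans p<y y<q)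
... | tri> _ _ k'<k = below k' (⊓-glb (ℕ.<-trans k'<k k<c) k'<c')
  (≈[]-trans (≈[]-mono (<⇒≤ k'<k) p≈y) y≈q) (subst (_<ℚ _) (sym (at p≈y k' k'<k)) y<q)

<[]-mono : c ≤ c' → p <[ c ] q → p <[ c' ] q
<[]-mono c≤c' (below k k<c p≈q p<q) = below k (<-≤-trans k<c c≤c') p≈q p<q

<[]-irrefl : ¬ p <[ c ] p
<[]-irrefl (below _ _ _ p<p) = ℚₚ.<-irrefl refl p<p

<ₙ⇒<[n] : {p q : Pt n} → p <ₙ q → p <[ n ] q
<ₙ⇒<[n] (k , p≈q , p<q) = below k (toℕ<n k) (agree p≈q) p<q

<[]⇒<ₙ : p <[ c ] q → p <ₙ q
<[]⇒<ₙ (below k _ p≈q p<q) = k , at p≈q , p<q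

<[]-<ₙ-trans : p <[ c ] y → y <ₙ q → p <[ c ] q
<[]-<ₙ-trans {c = c} p<y y<q = <[]-mono (m⊓n≤m c _) (<[]-trans p<y (<ₙ⇒<[n] y<q))

<ₙ-<[]-trans : p <ₙ y → y <[ c ] q → p <[ c ] q
<ₙ-<[]-trans {c = c} p<y y<q = <[]-mono (m⊓n≤n _ c) (<[]-trans (<ₙ⇒<[n] p<y) y<q)

<[]-respˡ-≈ : p ≈[ c ] y → p <[ c ] q → y <[ c ] q
<[]-respˡ-≈ p≈y (below k k<c p≈q p<q) =
  below k k<c (≈[]-trans (≈[]-sym (≈[]-mono (<⇒≤ k<c) p≈y)) p≈q) (subst (_<ℚ _) (at p≈y k k<c) p<q)

<[]-respʳ-≈ : q ≈[ c ] y → p <[ c ] q → p <[ c ] y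
<[]-respʳ-≈ q≈y (below k k<c p≈q p<q) =
  below k k<c (≈[]-trans p≈q (≈[]-mono (<⇒≤ k<c) q≈y)) (subst (_ <ℚ_) (at q≈y k k<c) p<q)

Compare[_] : ℕ → Pt n → Pt n → Set
Compare[ c ] p q = p <[ c ] q ⊎ q <[ c ] p ⊎ p ≈[ c ] q

<[]-trichotomy-step : {p q : Pt n} (k : Fin n) → p ≈[ toℕ k ] q → Compare[ suc (toℕ k) ] p q
<[]-trichotomy-step {p = p} {q = q} k p≈q with ℚₚ.<-cmp (lookup p k) (lookup q k)
... | tri< p<q _ _ = inj₁ (below k (n<1+n _) p≈q p<q)
... | tri> _ _ q<p = inj₂ (inj₁ (below k (n<1+n _) (≈[]-sym p≈q) q<p))
... | tri≈ _ eq _ = inj₂ (inj₂ (≈[]-extend k p≈q eq))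

<[]-trichotomy : ∀ c → c ≤ n → (p q : Pt n) → Compare[ c ] p q
<[]-trichotomy zero _ p q = inj₂ (inj₂ (agree λ _ ()))
<[]-trichotomy (suc c) c<n p q with <[]-trichotomy c (<⇒≤ c<n) p q
... | inj₁ p<q = inj₁ (<[]-mono (n≤1+n c) p<q)
... | inj₂ (inj₁ q<p) = inj₂ (inj₁ (<[]-mono (n≤1+n c) q<p))
... | inj₂ (inj₂ p≈q) = subst (λ c → Compare[ suc c ] p q) (toℕ-fromℕ< c<n)
  (<[]-trichotomy-step (fromℕ< c<n) (subst (p ≈[_] q) (sym (toℕ-fromℕ< c<n)) p≈q))

<[]-cotrans : {p q : Pt n} → c ≤ n → p <[ c ] q → (y : Pt n) → p <[ c ] y ⊎ y <[ c ] q
<[]-cotrans {c = c} {p = p} c≤n p<q y with <[]-trichotomy c c≤n p y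
... | inj₁ p<y = inj₁ p<y
... | inj₂ (inj₁ y<p) = inj₂ (<[]-<ₙ-trans y<p (<[]⇒<ₙ p<q))
... | inj₂ (inj₂ p≈y) = inj₂ (<[]-respˡ-≈ p≈y p<q)

x-1<x : (x : ℚ) → x - 1ℚ <ℚ x
x-1<x x = subst (x - 1ℚ <ℚ_) (ℚₚ.+-identityʳ x) (ℚₚ.+-monoʳ-< x (ℚₚ.negative⁻¹ (ℚ.- 1ℚ)))

lower : Fin n → Pt n → Pt n
lower k q = q [ k ]≔ (lookup q k - 1ℚ)

lower-<[] : (k : Fin n) (q : Pt n) → lower k q <[ suc (toℕ k) ] q
lower-<[] k q = below k (n<1+n _)
  (agree λ m m<k → lookup∘update′ (λ m≡k → ℕ.<-irrefl (cong toℕ m≡k) m<k) q _)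
  (subst (_<ℚ lookup q k) (sym (lookup∘update k q _)) (x-1<x (lookup q k)))

∃-agreeing-below : c < c' → c' ≤ n → (q : Pt n) → Σ (Pt n) λ y → y ≈[ c ] q × y <[ c' ] q
∃-agreeing-below {c = c} {c' = suc e} (s≤s c≤e) e<n q =
  lower k q , ≈[]-mono (subst (c ≤_) (sym k≡e) c≤e) (agree-below (lower-<[] k q)) ,
  subst (λ e → lower k q <[ suc e ] q) k≡e (lower-<[] k q)
  where
  k : Fin _
  k = fromℕ< e<n
  k≡e : toℕ k ≡ e
  k≡e = toℕ-fromℕ< e<n

α-involutive : (x : X n) → x ≡ α (α x)
α-involutive (p , b) = cong (p ,_) (sym (opposite-involutive b))

R₋⇔ : ∀ m (x z : X n) → R -[1+ m ] x z ⇔ proj₁ x <[ n ∸ m ] proj₁ z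
R₋⇔ m x z = mk⇔ (λ (k , k<c , p≈q , p<q) → below k k<c (agree p≈q) p<q)
                (λ (below k k<c p≈q p<q) → k , k<c , at p≈q , p<q)

R₊⇔ : ∀ m (x z : X n) → R (+ suc m) x z ⇔ (¬ proj₁ z <[ n ∸ m ] proj₁ x)
R₊⇔ m x z = mk⇔ ⇒ ⇐
  where
  ⇒ : R (+ suc m) x z → ¬ proj₁ z <[ _ ∸ m ] proj₁ x
  ⇒ (y , y≮x , refl) y<x = y≮x (from (R₋⇔ m y x) y<x)
  ⇐ : ¬ proj₁ z <[ _ ∸ m ] proj₁ x → R (+ suc m) x z
  ⇐ z≮x = α z , (λ z<x → z≮x (to (R₋⇔ m (α z) x) z<x)) , α-involutive z

R₋∘R₀ : ∀ m (x z : X n) → (R -[1+ m ] ∘ᵣ R (+ 0)) x z ⇔ R -[1+ m ] x z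
R₋∘R₀ m x z = mk⇔ ⇒ λ x<z → z , x<z , inj₁ refl
  where
  ⇒ : (R -[1+ m ] ∘ᵣ R (+ 0)) x z → R -[1+ m ] x z
  ⇒ (_ , x<y , inj₁ refl) = x<y
  ⇒ (y , x<y , inj₂ y<z) = from (R₋⇔ m x z) (<[]-<ₙ-trans (to (R₋⇔ m x y) x<y) y<z)

R₋∘R₋ : m' < m → m ≤ n → (x z : X n) → (R -[1+ m ] ∘ᵣ R -[1+ m' ]) x z ⇔ R -[1+ m ] x z
R₋∘R₋ {m'} {m} {n} m'<m m≤n x z = mk⇔ ⇒ ⇐
  where
  ⇒ : (R -[1+ m ] ∘ᵣ R -[1+ m' ]) x z → R -[1+ m ] x z
  ⇒ (y , x<y , y<z) =
    from (R₋⇔ m x z) (<[]-<ₙ-trans (to (R₋⇔ m x y) x<y) (<[]⇒<ₙ (to (R₋⇔ m' y z) y<z)))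
  ⇐ : R -[1+ m ] x z → (R -[1+ m ] ∘ᵣ R -[1+ m' ]) x z
  ⇐ x<z with ∃-agreeing-below (∸-monoʳ-< m'<m m≤n) (m∸n≤m n m') (proj₁ z)
  ... | y , y≈z , y<z = (y , proj₂ x) ,
    from (R₋⇔ m x (y , proj₂ x)) (<[]-respʳ-≈ (≈[]-sym y≈z) (to (R₋⇔ m x z) x<z)) ,
    from (R₋⇔ m' (y , proj₂ x) z) y<z

R₋∘R₊ : m' < m → (x z : X n) → (R -[1+ m ] ∘ᵣ R (+ suc m')) x z ⇔ R -[1+ m ] x z
R₋∘R₊ {m'} {m} {n} m'<m x z = mk⇔ ⇒ λ x<z → z , x<z , from (R₊⇔ m' z z) <[]-irrefl
  where
  ⇒ : (R -[1+ m ] ∘ᵣ R (+ suc m')) x z → R -[1+ m ] x z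
  ⇒ (y , x<y , z≮y) =
    [ from (R₋⇔ m x z)
    , (λ z<y → ⊥-elim (to (R₊⇔ m' y z) z≮y (<[]-mono (∸-monoʳ-≤ n (<⇒≤ m'<m)) z<y)))
    ] (<[]-cotrans (m∸n≤m n m) (to (R₋⇔ m x y) x<y) (proj₁ z))

R₊∘R₀ : ∀ m (x z : X n) → (R (+ suc m) ∘ᵣ R (+ 0)) x z ⇔ R (+ suc m) x z
R₊∘R₀ m x z = mk⇔ ⇒ λ y≮x → z , y≮x , inj₁ refl
  where
  ⇒ : (R (+ suc m) ∘ᵣ R (+ 0)) x z → R (+ suc m) x z
  ⇒ (_ , z≮x , inj₁ refl) = z≮x
  ⇒ (y , y≮x , inj₂ y<z) = from (R₊⇔ m x z) λ z<x → to (R₊⇔ m x y) y≮x (<ₙ-<[]-trans y<z z<x)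

R₊∘R₋ : m' < m → m ≤ n → (x z : X n) → (R (+ suc m) ∘ᵣ R -[1+ m' ]) x z ⇔ R (+ suc m) x z
R₊∘R₋ {m'} {m} {n} m'<m m≤n x z = mk⇔ ⇒ ⇐
  where
  ⇒ : (R (+ suc m) ∘ᵣ R -[1+ m' ]) x z → R (+ suc m) x z
  ⇒ (y , y≮x , y<z) = from (R₊⇔ m x z) λ z<x →
    to (R₊⇔ m x y) y≮x (<ₙ-<[]-trans (<[]⇒<ₙ (to (R₋⇔ m' y z) y<z)) z<x)
  ⇐ : R (+ suc m) x z → (R (+ suc m) ∘ᵣ R -[1+ m' ]) x z
  ⇐ z≮x with ∃-agreeing-below (∸-monoʳ-< m'<m m≤n) (m∸n≤m n m') (proj₁ z)
  ... | y , y≈z , y<z = (y , proj₂ z) ,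
    from (R₊⇔ m x (y , proj₂ z)) (λ y<x → to (R₊⇔ m x z) z≮x (<[]-respˡ-≈ y≈z y<x)) ,
    from (R₋⇔ m' (y , proj₂ z) z) y<z

R₊∘R₊ : m' < m → (x z : X n) → (R (+ suc m) ∘ᵣ R (+ suc m')) x z ⇔ R (+ suc m) x z
R₊∘R₊ {m'} {m} {n} m'<m x z = mk⇔ ⇒ λ z≮x → z , z≮x , from (R₊⇔ m' z z) <[]-irrefl
  where
  ⇒ : (R (+ suc m) ∘ᵣ R (+ suc m')) x z → R (+ suc m) x z
  ⇒ (y , y≮x , z≮y) = from (R₊⇔ m x z) λ z<x →
    [ (λ z<y → to (R₊⇔ m' y z) z≮y (<[]-mono (∸-monoʳ-≤ n (<⇒≤ m'<m)) z<y))
    , to (R₊⇔ m x y) y≮x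
    ] (<[]-cotrans (m∸n≤m n m) z<x (proj₁ y))

lemma3p7 : (n : ℕ) → 1 ≤ n → (i j : ℤ) →
  (- (+ (Data.Nat.suc n)) ≤ℤ i) × (i ≤ℤ + (Data.Nat.suc n)) →
  (- (+ (Data.Nat.suc n)) ≤ℤ j) × (j ≤ℤ + (Data.Nat.suc n)) →
  ∣ j ∣ < ∣ i ∣ →
  (x y : X n) → (R {n} i ∘ᵣ R {n} j) x y ⇔ R {n} i x y
lemma3p7 n _ (+ zero)  _          _                       _ ()
lemma3p7 n _ -[1+ m ]  (+ zero)   _                       _ _          = R₋∘R₀ m
lemma3p7 n _ -[1+ m ]  (+ suc m') _                       _ (s≤s m'<m) = R₋∘R₊ m'<m
lemma3p7 n _ -[1+ m ]  -[1+ m' ]  (-≤- m≤n , _)           _ (s≤s m'<m) = R₋∘R₋ m'<m m≤n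
lemma3p7 n _ (+ suc m) (+ zero)   _                       _ _          = R₊∘R₀ m
lemma3p7 n _ (+ suc m) (+ suc m') _                       _ (s≤s m'<m) = R₊∘R₊ m'<m
lemma3p7 n _ (+ suc m) -[1+ m' ]  (_ , +≤+ (s≤s m≤n))     _ (s≤s m'<m) = R₊∘R₋ m'<m m≤n
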